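{- For all integers $k,l\geq 1$, the common product $SPC(k)\circ SPC(l)$ is isomorphic to $SPC(k+l)$.
   Context: A signed graph $(G,\sigma)$ is a graph $G$ together with $\sigma:E(G)\to\{+,-\}$; between two vertices there may be at most one positive and at most one negative edge. For an abelian group $\Gamma$ and symmetric subsets $S^+,S^-\subseteq\Gamma$, the signed Cayley graph $(\Gamma,S^+,S^-)$ has vertex set $\Gamma$, a positive edge $xy$ iff $x-y\in S^+$ and a negative edge $xy$ iff $x-y\in S^-$. The signed projective cube of dimension $k\ge1$ is $SPC(k)=(\mathbb{Z}_2^k,\{e_1,\dots,e_k\},\{J\})$ with $e_i$ the standard basis vectors and $J$ the all-ones vector, with exactly this signature. The common product $(G,\sigma)\circ(H,\pi)$ of two signed graphs has vertex set $V(G)\times V(H)$; its positive edges form the Cartesian product of the subgraphs induced by the positive edges, i.e. $(x,u)(y,u)$ is a positive edge for each positive edge $xy$ of $(G,\sigma)$ and each $u\in V(H)$, and $(x,u)(x,v)$ is a positive edge for each $x\in V(G)$ and each positive edge $uv$ of $(H,\pi)$; its negative edges form the categorical product of the subgraphs induced by the negative edges, i.e. for each negative edge $xy$ of $(G,\sigma)$ and each negative edge $uv$ of $(H,\pi)$, $(x,u)(y,v)$ and $(x,v)(y,u)$ are negative edges. Isomorphism of signed graphs preserves edge signs. -}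

module Defs where

open import Data.Nat using (ℕ)
open import Data.Bool using (Bool; true; false; _xor_)
open import Data.Fin using (Fin; _≟_)
open import Data.Vec using (Vec; zipWith; replicate; tabulate)
open import Data.Product using (Σ; ∃; _×_; _,_)
open import Data.Sum using (_⊎_)
open import Relation.Nullary using (does)
open import Relation.Binary.PropositionalEquality using (_≡_)
open import Function.Bundles using (_⤖_; _⇔_; Bijection)

-- A signed graph: a vertex type with a positive and a negative edge relation.
-- (At most one positive and one negative edge between two vertices, so
-- edges are given by (symmetric) relations.)
record SignedGraph : Set₁ where
  field
    V   : Set
    Pos : V → V → Set
    Neg : V → V → Set
open SignedGraph public

-- Z_2^k as bit vectors; group operation is pointwise xor (x - y = x + y).
Z2^ : ℕ → Set
Z2^ k = Vec Bool k

_⊕_ : ∀ {k} → Z2^ k → Z2^ k → Z2^ k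
_⊕_ = zipWith _xor_

basis : ∀ {k} → Fin k → Z2^ k
basis i = tabulate (λ j → does (i ≟ j))

allOnes : ∀ k → Z2^ k
allOnes k = replicate k true

SPC : ℕ → SignedGraph
SPC k = record
  { V   = Z2^ k
  ; Pos = λ x y → ∃ λ (i : Fin k) → x ⊕ y ≡ basis i
  ; Neg = λ x y → x ⊕ y ≡ allOnes k
  }

_∘ₛ_ : SignedGraph → SignedGraph → SignedGraph
G ∘ₛ H = record
  { V   = V G × V H
  ; Pos = λ { (x , u) (y , v) →
              (Pos G x y × u ≡ v) ⊎ (x ≡ y × Pos H u v) }
  ; Neg = λ { (x , u) (y , v) → Neg G x y × Neg H u v }
  }

record _≅ₛ_ (G H : SignedGraph) : Set where
  field
    bij    : V G ⤖ V H
  open Bijection bij using (to)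
  field
    posIff : ∀ x y → Pos G x y ⇔ Pos H (to x) (to y)
    negIff : ∀ x y → Neg G x y ⇔ Neg H (to x) (to y)

-- Concatenation Z₂ᵏ × Z₂ˡ → Z₂ᵏ⁺ˡ is a group isomorphism, so the difference of
-- two concatenations is the concatenation of the differences.  It maps the
-- basis vectors of the factors, padded with zeros, onto the basis of Z₂ᵏ⁺ˡ, and
-- J ++ J onto J.  A difference (x ⊕ y) ++ (u ⊕ v) is therefore a basis vector
-- exactly when one component is a basis vector and the other is 0, i.e. a
-- Cartesian-product edge; it is J exactly when both components are J, i.e. a
-- categorical-product edge.
module Submission where

open import Defs
open import Data.Nat using (ℕ; _+_; _≤_; zero; suc)
open import Data.Bool using (true; false; _xor_)
open import Data.Bool.Properties using (xor-same; xor-assoc; xor-identityˡ; xor-identityʳ)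
open import Data.Fin using (Fin; _↑ˡ_; _↑ʳ_; splitAt) renaming (zero to fzero; suc to fsuc)
open import Data.Fin.Properties using (splitAt⁻¹-↑ˡ; splitAt⁻¹-↑ʳ)
open import Data.Vec using (Vec; []; _∷_; _++_; replicate; tabulate; take; drop)
open import Data.Vec.Properties
  using (zipWith-++; zipWith-assoc; zipWith-identityˡ; zipWith-identityʳ; ++-injective; take++drop≡id)
open import Data.Product using (_×_; _,_)
open import Data.Sum using (inj₁; inj₂)
open import Relation.Binary.PropositionalEquality
open import Function.Bundles using (_⤖_; _⇔_; Equivalence; mk⇔; mk↔ₛ′)
import Function.Properties.Equivalence as ⇔
open import Function.Properties.Inverse using (↔⇒⤖)

zeros : ∀ k → Z2^ k
zeros k = replicate k false

⊕-self : ∀ {k} (x : Z2^ k) → x ⊕ x ≡ zeros k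
⊕-self []      = refl
⊕-self (a ∷ x) = cong₂ _∷_ (xor-same a) (⊕-self x)

⊕≡zeros⇒≡ : ∀ {k} (x y : Z2^ k) → x ⊕ y ≡ zeros k → x ≡ y
⊕≡zeros⇒≡ {k} x y x⊕y≡0 = sym (begin
  y              ≡⟨ zipWith-identityˡ xor-identityˡ y ⟨
  zeros k ⊕ y    ≡⟨ cong (_⊕ y) (⊕-self x) ⟨
  (x ⊕ x) ⊕ y    ≡⟨ zipWith-assoc xor-assoc x x y ⟩
  x ⊕ (x ⊕ y)    ≡⟨ cong (x ⊕_) x⊕y≡0 ⟩
  x ⊕ zeros k    ≡⟨ zipWith-identityʳ xor-identityʳ x ⟩
  x              ∎)
  where open ≡-Reasoning

replicate-++ : ∀ {A : Set} k l (a : A) → replicate (k + l) a ≡ replicate k a ++ replicate l a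
replicate-++ zero    l a = refl
replicate-++ (suc k) l a = cong (a ∷_) (replicate-++ k l a)

tabulate-false : ∀ k → tabulate {n = k} (λ _ → false) ≡ zeros k
tabulate-false zero    = refl
tabulate-false (suc k) = cong (false ∷_) (tabulate-false k)

basis-↑ˡ : ∀ {k} l (i : Fin k) → basis (i ↑ˡ l) ≡ basis i ++ zeros l
basis-↑ˡ {suc k} l fzero = cong (true ∷_) (begin
  tabulate (λ _ → false)               ≡⟨ tabulate-false (k + l) ⟩
  zeros (k + l)                        ≡⟨ replicate-++ k l false ⟩
  zeros k ++ zeros l                   ≡⟨ cong (_++ zeros l) (tabulate-false k) ⟨
  tabulate (λ _ → false) ++ zeros l    ∎)
  where open ≡-Reasoning
basis-↑ˡ {suc k} l (fsuc i) = cong (false ∷_) (basis-↑ˡ l i)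

basis-↑ʳ : ∀ k {l} (j : Fin l) → basis (k ↑ʳ j) ≡ zeros k ++ basis j
basis-↑ʳ zero    j = refl
basis-↑ʳ (suc k) j = cong (false ∷_) (basis-↑ʳ k j)

module _ {k l : ℕ} where

  ++-⤖ : (Z2^ k × Z2^ l) ⤖ Z2^ (k + l)
  ++-⤖ = ↔⇒⤖ (mk↔ₛ′ (λ (x , u) → x ++ u) (λ v → take k v , drop k v)
                      (take++drop≡id k) take-drop-++)
    where
    take-drop-++ : ((x , u) : Z2^ k × Z2^ l) → (take k (x ++ u) , drop k (x ++ u)) ≡ (x , u)
    take-drop-++ (x , u) with ++-injective (take k (x ++ u)) x (take++drop≡id k (x ++ u))
    ... | take≡x , drop≡u = cong₂ _,_ take≡x drop≡u

  ⊕-++≡++⇔ : (x y a : Z2^ k) (u v b : Z2^ l) →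
             (x ++ u) ⊕ (y ++ v) ≡ a ++ b ⇔ (x ⊕ y ≡ a × u ⊕ v ≡ b)
  ⊕-++≡++⇔ x y a u v b = mk⇔
    (λ e → ++-injective (x ⊕ y) a (trans (sym (zipWith-++ _xor_ x u y v)) e))
    (λ (e₁ , e₂) → trans (zipWith-++ _xor_ x u y v) (cong₂ _++_ e₁ e₂))

  neg-++⇔ : (x y : Z2^ k) (u v : Z2^ l) →
            Neg (SPC k ∘ₛ SPC l) (x , u) (y , v) ⇔ Neg (SPC (k + l)) (x ++ u) (y ++ v)
  neg-++⇔ x y u v rewrite replicate-++ k l true =
    ⇔.sym (⊕-++≡++⇔ x y (allOnes k) u v (allOnes l))

  pos-++⇔ : (x y : Z2^ k) (u v : Z2^ l) →
            Pos (SPC k ∘ₛ SPC l) (x , u) (y , v) ⇔ Pos (SPC (k + l)) (x ++ u) (y ++ v)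
  pos-++⇔ x y u v = mk⇔ edge⇒ ⇒edge
    where
    module D a b = Equivalence (⊕-++≡++⇔ x y a u v b)

    edge⇒ : Pos (SPC k ∘ₛ SPC l) (x , u) (y , v) → Pos (SPC (k + l)) (x ++ u) (y ++ v)
    edge⇒ (inj₁ ((i , e) , refl)) =
      i ↑ˡ l , trans (D.from (basis i) (zeros l) (e , ⊕-self u)) (sym (basis-↑ˡ l i))
    edge⇒ (inj₂ (refl , (j , e))) =
      k ↑ʳ j , trans (D.from (zeros k) (basis j) (⊕-self x , e)) (sym (basis-↑ʳ k j))

    ⇒edge : Pos (SPC (k + l)) (x ++ u) (y ++ v) → Pos (SPC k ∘ₛ SPC l) (x , u) (y , v)
    ⇒edge (i , e) with splitAt k i in split≡
    ... | inj₁ i′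
      with e₁ , e₂ ← D.to (basis i′) (zeros l)
                       (trans e (trans (cong basis (sym (splitAt⁻¹-↑ˡ split≡))) (basis-↑ˡ l i′)))
      = inj₁ ((i′ , e₁) , ⊕≡zeros⇒≡ u v e₂)
    ... | inj₂ j
      with e₁ , e₂ ← D.to (zeros k) (basis j)
                       (trans e (trans (cong basis (sym (splitAt⁻¹-↑ʳ split≡))) (basis-↑ʳ k j)))
      = inj₂ (⊕≡zeros⇒≡ x y e₁ , (j , e₂))

-- The isomorphism exists for k = 0 and l = 0 as well, so the bounds are unused.
mainTheorem2 : ∀ (k l : ℕ) → 1 ≤ k → 1 ≤ l → (SPC k ∘ₛ SPC l) ≅ₛ SPC (k + l)
mainTheorem2 k l _ _ = record
  { bij    = ++-⤖
  ; posIff = λ (x , u) (y , v) → pos-++⇔ x y u v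
  ; negIff = λ (x , u) (y , v) → neg-++⇔ x y u v
  }
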